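{- Let $\omega$ be a permutation of $[n]$, and let $\mathcal{C}^0$ be the collection consisting of $\emptyset$ together with all sets $I^k_\omega\cap[j..n]$ for $1\le k\le n$, $1\le j\le\omega^{ -1}(k)$. Let $X\subset[n]$ satisfy $X\notin\mathcal{C}^0$ and be weakly separated from every member of $\mathcal{C}^0$; let $k=|X|$ and $Y=I^k_\omega$. If $X\lessdot Y$, then $X$ is an $\omega$-chamber set.
   Context: $[j..n]=\{j,\dots,n\}$, $I^k_\omega=\{i:\omega(i)\le k\}$, $I^0_\omega=\emptyset$. For $A,B\subseteq[n]$ write $A\lessdot B$ if $B-A\neq\emptyset$ and $i<j$ for all $i\in A-B$, $j\in B-A$. Write $A\rhd B$ if both $A-B$ and $B-A$ are nonempty and $B-A$ is a disjoint union $B'\sqcup B''$ of nonempty sets with $b'<a<b''$ for all $b'\in B'$, $a\in A-B$, $b''\in B''$. Sets $A,B$ are weakly separated if $A\lessdot B$, or $B\lessdot A$, or ($A\rhd B$ and $|A|\ge|B|$), or ($B\rhd A$ and $|B|\ge|A|$), or $A=B$. A set $X\subseteq[n]$ is an $\omega$-chamber set if $i\in X$, $j<i$ and $\omega(j)<\omega(i)$ imply $j\in X$. -}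

module Defs where

-- Conventions: [n] = {1,…,n} is represented by Fin n, element i : Fin n
-- standing for the integer toℕ i + 1 (order-preserving).  A permutation ω of [n] is a
-- Permutation′ n; the value ω(i) ∈ [n] is  suc (toℕ (ω ⟨$⟩ʳ i)).

open import Data.Nat using (ℕ; suc; _≤_; _≤?_)
open import Data.Fin using (Fin; toℕ; _<_)
open import Data.Fin.Subset using (Subset; _∈_; _∉_; _∩_; _∪_; _─_; ∣_∣; Nonempty; ⊥)
open import Data.Fin.Permutation using (Permutation′; _⟨$⟩ʳ_; _⟨$⟩ˡ_)
open import Data.Vec using (tabulate)
open import Data.Product using (Σ; _×_; ∃; ∃-syntax)
open import Data.Sum using (_⊎_)
open import Relation.Nullary.Decidable using (⌊_⌋)
open import Relation.Binary.PropositionalEquality using (_≡_)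

private variable n : ℕ

val : Permutation′ n → Fin n → ℕ
val ω i = suc (toℕ (ω ⟨$⟩ʳ i))

I : Permutation′ n → ℕ → Subset n
I ω k = tabulate (λ i → ⌊ val ω i ≤? k ⌋)

interval : (n j : ℕ) → Subset n
interval n j = tabulate (λ (i : Fin n) → ⌊ j ≤? suc (toℕ i) ⌋)

_⋖_ : Subset n → Subset n → Set
A ⋖ B = Nonempty (B ─ A) × (∀ i j → i ∈ A ─ B → j ∈ B ─ A → i < j)

_⊳_ : Subset n → Subset n → Set
A ⊳ B = Nonempty (A ─ B) × Nonempty (B ─ A) ×
  (Σ (Subset _) λ B′ → Σ (Subset _) λ B″ →
      (B′ ∩ B″ ≡ ⊥) × (B′ ∪ B″ ≡ B ─ A) × Nonempty B′ × Nonempty B″ ×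
      (∀ b′ a b″ → b′ ∈ B′ → a ∈ A ─ B → b″ ∈ B″ → (b′ < a) × (a < b″)))

WeaklySeparated : Subset n → Subset n → Set
WeaklySeparated A B =
  (A ⋖ B) ⊎ (B ⋖ A) ⊎ ((A ⊳ B) × ∣ B ∣ ≤ ∣ A ∣) ⊎ ((B ⊳ A) × ∣ A ∣ ≤ ∣ B ∣) ⊎ (A ≡ B)

ChamberSet : Permutation′ n → Subset n → Set
ChamberSet ω X = ∀ i j → i ∈ X → j < i → val ω j Data.Nat.< val ω i → j ∈ X

-- membership in 𝒞⁰ = {∅} ∪ { I^k_ω ∩ [j..n] : 1 ≤ k ≤ n, 1 ≤ j ≤ ω⁻¹(k) }.
-- k ∈ [n] is represented by kf : Fin n with k = suc (toℕ kf);
-- ω⁻¹(k) ∈ [n] is then suc (toℕ (ω ⟨$⟩ˡ kf)).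
InC⁰ : Permutation′ n → Subset n → Set
InC⁰ {n} ω S = (S ≡ ⊥) ⊎
  (Σ (Fin n) λ kf → Σ ℕ λ j →
      (1 ≤ j) × (j ≤ suc (toℕ (ω ⟨$⟩ˡ kf))) × (S ≡ I ω (suc (toℕ kf)) ∩ interval n j))

module Submission where

-- Suppose X is not an ω-chamber set: there are i ∈ X and j ∉ X
-- with j < i and ω(j) < ω(i).  Let Z = I^m_ω for m = ω(j); it lies in 𝒞⁰
-- (as I^m_ω ∩ [1..n]), and i ∈ X − Z, j ∈ Z − X form a "crossing pair" (the element
-- of Z − X comes first), which already rules out X ⋖ Z and X = Z.  The sets
-- I^k_ω form a chain with |I^k_ω| = k, so Z is comparable with Y = I^{|X|}_ω,
-- and |Y| = |X|.  In either case (Z ⊆ Y or Y ⊆ Z) the hypothesis X ⋖ Y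
-- locates X − Z and Z − X precisely enough to refute the remaining three
-- forms of weak separation; hence X is a chamber set.

open import Defs
open import Data.Nat using (ℕ; zero; suc; _≤_; _≤?_; z≤n; s≤s)
open import Data.Nat.Properties using (+-0-commutativeMonoid; ≤-pred; ≤-refl; ≤-trans; ≤-total; <⇒≱; <-irrefl)
open import Data.Bool using (Bool; true; false; T; if_then_else_)
open import Data.Bool.Properties using (T-≡)
open import Data.Fin using (Fin; toℕ; _<_)
open import Data.Fin.Properties using (<-asym)
open import Data.Fin.Subset using (Subset; ∣_∣; _∈_; _∉_; _∩_; _─_; _∪_; _⊆_; Nonempty; ⊤)
open import Data.Fin.Subset.Properties
  using (_∈?_; nonempty?; x∈p∧x∉q⇒x∈p─q; p─q⊆p; p⊆p∪q; q⊆p∪q; p⊂q⇒∣p∣<∣q∣; ∣p∣≤n; ∩-identityʳ)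
open import Data.Fin.Permutation using (Permutation′; _⟨$⟩ʳ_)
open import Data.Vec using (tabulate; _∷_; here; there)
open import Data.Vec.Properties using (lookup∘tabulate; []=⇒lookup; lookup⇒[]=)
open import Data.Product using (_,_; _×_; proj₁; proj₂)
open import Data.Sum using (_⊎_; inj₁; inj₂)
open import Data.Empty using (⊥-elim) renaming (⊥ to Absurd)
open import Function.Bundles using (Equivalence)
open import Relation.Nullary using (¬_; yes; no)
open import Relation.Nullary.Decidable using (⌊_⌋; toWitness; fromWitness)
open import Relation.Binary.PropositionalEquality using (_≡_; refl; sym; trans; cong; subst; module ≡-Reasoning)
open import Algebra.Properties.CommutativeMonoid.Sum +-0-commutativeMonoid using (sum; sum-permute; sum-cong-≗)

private variable
  n : ℕ
  x : Fin n
  p q r : Subset n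

∈─⇒∉ : ∀ (p q : Subset n) → x ∈ p ─ q → x ∉ q
∈─⇒∉ (true  ∷ p) (true  ∷ q) () here
∈─⇒∉ (false ∷ p) (true  ∷ q) () here
∈─⇒∉ (_     ∷ p) (_     ∷ q) (there x∈p─q) (there x∈q) = ∈─⇒∉ p q x∈p─q x∈q

─-monoˡ : p ⊆ q → p ─ r ⊆ q ─ r
─-monoˡ {p = p} {r = r} p⊆q x∈p─r = x∈p∧x∉q⇒x∈p─q (p⊆q (p─q⊆p p r x∈p─r)) (∈─⇒∉ p r x∈p─r)

─-antitoneʳ : p ⊆ q → r ─ q ⊆ r ─ p
─-antitoneʳ {q = q} {r = r} p⊆q x∈r─q =
  x∈p∧x∉q⇒x∈p─q (p─q⊆p r q x∈r─q) (λ x∈p → ∈─⇒∉ r q x∈r─q (p⊆q x∈p))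

∪-partˡ : p ∪ q ≡ r → p ⊆ r
∪-partˡ {q = q} refl = p⊆p∪q q

∪-partʳ : p ∪ q ≡ r → q ⊆ r
∪-partʳ {p = p} {q = q} refl = q⊆p∪q p q

-- For sets of equal size, q ⊈ p implies p ⊈ q (a proper subset is strictly
-- smaller).
equal-size-diff : ∣ p ∣ ≡ ∣ q ∣ → Nonempty (q ─ p) → Nonempty (p ─ q)
equal-size-diff {p = p} {q = q} same (y , y∈q─p) with nonempty? (p ─ q)
... | yes ne = ne
... | no ¬ne = ⊥-elim (<-irrefl same (p⊂q⇒∣p∣<∣q∣ (p⊆q , y , p─q⊆p q p y∈q─p , ∈─⇒∉ q p y∈q─p)))
  where
  p⊆q : p ⊆ q
  p⊆q {z} z∈p with z ∈? q
  ... | yes z∈q = z∈q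
  ... | no z∉q = ⊥-elim (¬ne (z , x∈p∧x∉q⇒x∈p─q z∈p z∉q))

∈-tabulate⁻ : (f : Fin n → Bool) {x : Fin n} → x ∈ tabulate f → T (f x)
∈-tabulate⁻ f {x} x∈ = Equivalence.from T-≡ (trans (sym (lookup∘tabulate f x)) ([]=⇒lookup x∈))

∈-tabulate⁺ : (f : Fin n → Bool) {x : Fin n} → T (f x) → x ∈ tabulate f
∈-tabulate⁺ f {x} fx = lookup⇒[]= x (tabulate f) (trans (lookup∘tabulate f x) (Equivalence.to T-≡ fx))

indicator : Bool → ℕ
indicator b = if b then 1 else 0

∣tabulate∣ : (f : Fin n → Bool) → ∣ tabulate f ∣ ≡ sum (λ i → indicator (f i))
∣tabulate∣ {zero}  f = refl
∣tabulate∣ {suc n} f with f Fin.zero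
... | true  = cong suc (∣tabulate∣ (λ i → f (Fin.suc i)))
... | false = ∣tabulate∣ (λ i → f (Fin.suc i))

∈I⁻ : (ω : Permutation′ n) {k : ℕ} → x ∈ I ω k → val ω x ≤ k
∈I⁻ ω x∈I = toWitness (∈-tabulate⁻ _ x∈I)

∈I⁺ : (ω : Permutation′ n) {k : ℕ} → val ω x ≤ k → x ∈ I ω k
∈I⁺ ω ωx≤k = ∈-tabulate⁺ _ (fromWitness ωx≤k)

I-mono : (ω : Permutation′ n) {k l : ℕ} → k ≤ l → I ω k ⊆ I ω l
I-mono ω k≤l x∈I = ∈I⁺ ω (≤-trans (∈I⁻ ω x∈I) k≤l)

shift-test : ∀ a k → ⌊ suc (suc a) ≤? suc k ⌋ ≡ ⌊ suc a ≤? k ⌋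
shift-test a k with suc (suc a) ≤? suc k | suc a ≤? k
... | yes _         | yes _   = refl
... | no  _         | no  _   = refl
... | yes a+1<k+1   | no  a≮k = ⊥-elim (a≮k (≤-pred a+1<k+1))
... | no  a+1≮k+1   | yes a<k = ⊥-elim (a+1≮k+1 (s≤s a<k))

count-initial : ∀ n k → k ≤ n → sum (λ (y : Fin n) → indicator ⌊ suc (toℕ y) ≤? k ⌋) ≡ k
count-initial zero    .zero z≤n       = refl
count-initial (suc n) zero    z≤n     = count-initial n zero z≤n
count-initial (suc n) (suc k) (s≤s k≤n) = cong suc (trans
  (sum-cong-≗ {n} (λ y → cong indicator (shift-test (toℕ y) k))) (count-initial n k k≤n))

-- |I^k_ω| = k: I^k_ω is the preimage of {1, …, k} under the permutation ω.
∣I∣ : (ω : Permutation′ n) {k : ℕ} → k ≤ n → ∣ I ω k ∣ ≡ k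
∣I∣ {n} ω {k} k≤n = begin
  ∣ I ω k ∣                                           ≡⟨ ∣tabulate∣ (λ i → ⌊ val ω i ≤? k ⌋) ⟩
  sum (λ i → indicator ⌊ suc (toℕ (ω ⟨$⟩ʳ i)) ≤? k ⌋) ≡⟨ sum-permute initial ω ⟨
  sum initial                                         ≡⟨ count-initial n k k≤n ⟩
  k                                                   ∎
  where
  open ≡-Reasoning
  initial : Fin n → ℕ
  initial y = indicator ⌊ suc (toℕ y) ≤? k ⌋

interval-one : ∀ n → interval n 1 ≡ ⊤
interval-one zero    = refl
interval-one (suc n) = cong (true ∷_) (interval-one n)

-- Every I^k_ω with 1 ≤ k ≤ n belongs to 𝒞⁰, as I^k_ω ∩ [1..n].
I∈C⁰ : (ω : Permutation′ n) (kf : Fin n) → InC⁰ ω (I ω (suc (toℕ kf)))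
I∈C⁰ {n} ω kf = inj₂ (kf , 1 , s≤s z≤n , s≤s z≤n ,
  sym (trans (cong (I ω (suc (toℕ kf)) ∩_) (interval-one n)) (∩-identityʳ _)))

crossing-ws : ∀ {X Z : Subset n} {i j} → i ∈ X ─ Z → j ∈ Z ─ X → j < i →
  WeaklySeparated X Z →
  (Z ⋖ X) ⊎ ((X ⊳ Z) × ∣ Z ∣ ≤ ∣ X ∣) ⊎ ((Z ⊳ X) × ∣ X ∣ ≤ ∣ Z ∣)
crossing-ws i∈X─Z j∈Z─X j<i (inj₁ (_ , X-before-Z)) =
  ⊥-elim (<-asym j<i (X-before-Z _ _ i∈X─Z j∈Z─X))
crossing-ws _ _ _ (inj₂ (inj₁ Z⋖X))               = inj₁ Z⋖X
crossing-ws _ _ _ (inj₂ (inj₂ (inj₁ X⊳Z)))        = inj₂ (inj₁ X⊳Z)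
crossing-ws _ _ _ (inj₂ (inj₂ (inj₂ (inj₁ Z⊳X)))) = inj₂ (inj₂ Z⊳X)
crossing-ws {X = X} i∈X─X _ _ (inj₂ (inj₂ (inj₂ (inj₂ refl)))) =
  ⊥-elim (∈─⇒∉ X X i∈X─X (p─q⊆p X X i∈X─X))

-- Case Z ⊆ Y.  Then i ∈ Y (else i ∈ X − Y would precede j ∈ Y − X), so Z ⊊ Y
-- is smaller than X; and some a ∈ X − Y ⊆ X − Z precedes all of Y − X ⊇ Z − X.
ws-below : ∀ {X Y Z : Subset n} {i j} → Z ⊆ Y → ∣ Y ∣ ≡ ∣ X ∣ → X ⋖ Y →
  i ∈ X ─ Z → j ∈ Z ─ X → j < i → ¬ WeaklySeparated X Z
ws-below {X = X} {Y} {Z} {i} {j} Z⊆Y ∣Y∣≡∣X∣ (_ , X-before-Y) i∈X─Z j∈Z─X j<i ws =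
  refute (crossing-ws i∈X─Z j∈Z─X j<i ws)
  where
  j∈Y─X : j ∈ Y ─ X
  j∈Y─X = ─-monoˡ Z⊆Y j∈Z─X
  i∈Y : i ∈ Y
  i∈Y with i ∈? Y
  ... | yes i∈Y = i∈Y
  ... | no  i∉Y = ⊥-elim (<-asym j<i (X-before-Y i j (x∈p∧x∉q⇒x∈p─q (p─q⊆p X Z i∈X─Z) i∉Y) j∈Y─X))
  X─Y-element : Nonempty (X ─ Y)
  X─Y-element = equal-size-diff (sym ∣Y∣≡∣X∣) (j , j∈Y─X)
  a : Fin _
  a = proj₁ X─Y-element
  a∈X─Y : a ∈ X ─ Y
  a∈X─Y = proj₂ X─Y-element
  a∈X─Z : a ∈ X ─ Z
  a∈X─Z = ─-antitoneʳ Z⊆Y a∈X─Y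
  a<j : a < j
  a<j = X-before-Y a j a∈X─Y j∈Y─X
  refute : (Z ⋖ X) ⊎ ((X ⊳ Z) × ∣ Z ∣ ≤ ∣ X ∣) ⊎ ((Z ⊳ X) × ∣ X ∣ ≤ ∣ Z ∣) → Absurd
  refute (inj₁ (_ , Z-before-X)) = <-asym a<j (Z-before-X j a j∈Z─X a∈X─Z)
  refute (inj₂ (inj₁ ((_ , _ , _ , _ , _ , B′∪B″≡Z─X , (z , z∈B′) , (w , w∈B″) , order) , _))) =
    <-asym (proj₁ (order z a w z∈B′ a∈X─Z w∈B″))
           (X-before-Y a z a∈X─Y (─-monoˡ Z⊆Y (∪-partˡ B′∪B″≡Z─X z∈B′)))
  refute (inj₂ (inj₂ (_ , ∣X∣≤∣Z∣))) =
    <⇒≱ (p⊂q⇒∣p∣<∣q∣ (Z⊆Y , i , i∈Y , ∈─⇒∉ X Z i∈X─Z)) (subst (_≤ ∣ Z ∣) (sym ∣Y∣≡∣X∣) ∣X∣≤∣Z∣)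

-- Case Y ⊆ Z.  Then j ∉ Y (else i ∈ X − Y would precede j ∈ Y − X), so Y ⊊ Z
-- and Z is larger than X; and every element of X − Z ⊆ X − Y precedes some
-- b ∈ Y − X ⊆ Z − X.
ws-above : ∀ {X Y Z : Subset n} {i j} → Y ⊆ Z → ∣ Y ∣ ≡ ∣ X ∣ → X ⋖ Y →
  i ∈ X ─ Z → j ∈ Z ─ X → j < i → ¬ WeaklySeparated X Z
ws-above {X = X} {Y} {Z} {i} {j} Y⊆Z ∣Y∣≡∣X∣ ((b , b∈Y─X) , X-before-Y) i∈X─Z j∈Z─X j<i ws =
  refute (crossing-ws i∈X─Z j∈Z─X j<i ws)
  where
  i∈X─Y : i ∈ X ─ Y
  i∈X─Y = ─-antitoneʳ Y⊆Z i∈X─Z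
  j∉Y : j ∉ Y
  j∉Y j∈Y = <-asym j<i (X-before-Y i j i∈X─Y (x∈p∧x∉q⇒x∈p─q j∈Y (∈─⇒∉ Z X j∈Z─X)))
  b∈Z─X : b ∈ Z ─ X
  b∈Z─X = ─-monoˡ Y⊆Z b∈Y─X
  refute : (Z ⋖ X) ⊎ ((X ⊳ Z) × ∣ Z ∣ ≤ ∣ X ∣) ⊎ ((Z ⊳ X) × ∣ X ∣ ≤ ∣ Z ∣) → Absurd
  refute (inj₁ (_ , Z-before-X)) =
    <-asym (X-before-Y i b i∈X─Y b∈Y─X) (Z-before-X b i b∈Z─X i∈X─Z)
  refute (inj₂ (inj₁ (_ , ∣Z∣≤∣X∣))) =
    <⇒≱ (p⊂q⇒∣p∣<∣q∣ (Y⊆Z , j , p─q⊆p Z X j∈Z─X , j∉Y)) (subst (∣ Z ∣ ≤_) (sym ∣Y∣≡∣X∣) ∣Z∣≤∣X∣)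
  refute (inj₂ (inj₂ ((_ , _ , _ , _ , _ , B′∪B″≡X─Z , (z , z∈B′) , (w , w∈B″) , order) , _))) =
    <-asym (proj₂ (order z b w z∈B′ b∈Z─X w∈B″))
           (X-before-Y w b (─-antitoneʳ Y⊆Z (∪-partʳ B′∪B″≡X─Z w∈B″)) b∈Y─X)

-- A violating pair i, j yields the crossing pair for
-- Z = I^{ω(j)}_ω ∈ 𝒞⁰, and Z is comparable with Y = I^{|X|}_ω.
lemma2p4 : (n : ℕ) (ω : Permutation′ n) (X : Subset n) →
    ¬ InC⁰ ω X →
    (∀ S → InC⁰ ω S → WeaklySeparated X S) →
    X ⋖ I ω ∣ X ∣ →
    ChamberSet ω X
lemma2p4 n ω X _ separated X⋖Y i j i∈X j<i ωj<ωi with j ∈? X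
... | yes j∈X = j∈X
... | no  j∉X = ⊥-elim (refute (≤-total (val ω j) ∣ X ∣))
  where
  Z : Subset n
  Z = I ω (val ω j)
  i∈X─Z : i ∈ X ─ Z
  i∈X─Z = x∈p∧x∉q⇒x∈p─q i∈X (λ i∈Z → <⇒≱ ωj<ωi (∈I⁻ ω i∈Z))
  j∈Z─X : j ∈ Z ─ X
  j∈Z─X = x∈p∧x∉q⇒x∈p─q (∈I⁺ ω ≤-refl) j∉X
  ws : WeaklySeparated X Z
  ws = separated Z (I∈C⁰ ω (ω ⟨$⟩ʳ j))
  ∣Y∣≡∣X∣ : ∣ I ω ∣ X ∣ ∣ ≡ ∣ X ∣
  ∣Y∣≡∣X∣ = ∣I∣ ω (∣p∣≤n X)
  refute : (val ω j ≤ ∣ X ∣) ⊎ (∣ X ∣ ≤ val ω j) → Absurd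
  refute (inj₁ below) = ws-below (I-mono ω below) ∣Y∣≡∣X∣ X⋖Y i∈X─Z j∈Z─X j<i ws
  refute (inj₂ above) = ws-above (I-mono ω above) ∣Y∣≡∣X∣ X⋖Y i∈X─Z j∈Z─X j<i ws
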